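{- Let $g\ge 5$ be an integer. Every positive integer with exactly three base $g$ digits is a sum of two base $g$ palindromes, except $n=2g^2+1$ (base $g$ digits $2\,0\,1$), which is a sum of three base $g$ palindromes.
   Context: Every nonnegative integer has a unique base $g$ representation $\delta_{l-1}\cdots\delta_0$ with digits $0\le \delta_j\le g-1$ and $\delta_{l-1}\ne 0$; it is a base $g$ palindrome if $\delta_{l-i}=\delta_{i-1}$ for all $i=1,\dots,\lfloor l/2\rfloor$. By convention $0$ is also considered a base $g$ palindrome. -}

module Defs where

open import Data.Nat using (ℕ; zero; suc; _+_; _*_; _^_; _<_; _≤_; NonZero)
open import Data.Nat.DivMod using (_/_; _%_)
open import Data.List using (List; []; _∷_; reverse)
open import Data.Product using (∃-syntax; _×_)
open import Relation.Binary.PropositionalEquality using (_≡_)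

-- Base g digits of n, least significant first, computed with fuel.
-- With fuel ≥ n this is exactly the standard representation
-- (no leading zeros; 0 has the empty digit list).
digitsAux : (g : ℕ) → .{{NonZero g}} → ℕ → ℕ → List ℕ
digitsAux g zero    n       = []
digitsAux g (suc f) zero    = []
digitsAux g (suc f) (suc n) = (suc n % g) ∷ digitsAux g f (suc n / g)

digits : (g : ℕ) → .{{NonZero g}} → ℕ → List ℕ
digits g n = digitsAux g n n

-- n is a base g palindrome (0 is a palindrome by convention: [] is).
IsPalindrome : (g : ℕ) → .{{NonZero g}} → ℕ → Set
IsPalindrome g n = digits g n ≡ reverse (digits g n)

SumOfTwoPal : (g : ℕ) → .{{NonZero g}} → ℕ → Set
SumOfTwoPal g n = ∃[ a ] ∃[ b ] (IsPalindrome g a × IsPalindrome g b × n ≡ a + b)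

SumOfThreePal : (g : ℕ) → .{{NonZero g}} → ℕ → Set
SumOfThreePal g n =
  ∃[ a ] ∃[ b ] ∃[ c ] (IsPalindrome g a × IsPalindrome g b × IsPalindrome g c × n ≡ a + b + c)

-- Write (c b a) for a + g b + g² c.  For a three-digit n = (c b a): if c ≤ a then
-- n = (c b c) + (a − c); if a < c and b > 0, borrowing from the middle digit gives
-- n = (c (b−1) c) + (a + g − c).  If a < c and b = 0 one borrows from the leading digit:
-- n = ((c−1) (g−1) (c−1)) + (a + g − c + 1) when a + 1 < c, g² = ((g−1) (g−1)) + 1, and
-- n = (1 1 1) + ((c−2) (g−1) (c−2)) when c = a + 1 ≥ 3.  Only (2 0 1) = 2g² + 1 remains, and it
-- is not a sum of two palindromes: a summand ≥ g² is a palindrome (x y x); x ≥ 2 is too large,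
-- while x = 1 leaves g (g − y) for the other summand, but a positive multiple of g is never a
-- palindrome because a palindrome's last digit is its nonzero leading digit.  Finally
-- 2g² + 1 = (1 (g−1) 1) + (g − 1) + 1.

module Submission where

open import Defs
open import Data.Nat
open import Data.Nat.Properties
open import Data.Nat.DivMod
open import Data.Nat.Divisibility using (_∤_; m∣m*n; n∣m⇒m%n≡0)
open import Data.Nat.Tactic.RingSolver using (solve)
open import Data.List using ([]; _∷_; _∷ʳ_; reverse)
open import Data.List.Properties using (∷-injectiveˡ; reverse-++)
open import Data.Product using (∃₂; _×_; _,_)
open import Data.Sum using (inj₁; inj₂)
open import Data.Empty using (⊥-elim)
open import Relation.Binary.PropositionalEquality
open import Relation.Nullary using (¬_; yes; no)

module Base (g : ℕ) .{{_ : NonZero g}} (1<g : 1 < g) where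

  suc-/-≤ : ∀ n → suc n / g ≤ n
  suc-/-≤ n = ≤-pred (m/n<m (suc n) g 1<g)

  digitsAux-zero : ∀ f → digitsAux g f 0 ≡ []
  digitsAux-zero zero    = refl
  digitsAux-zero (suc f) = refl

  digitsAux-fuel : ∀ {f f′ n} → n ≤ f → n ≤ f′ → digitsAux g f n ≡ digitsAux g f′ n
  digitsAux-fuel {zero}  {f′}     {zero}  _ _ = sym (digitsAux-zero f′)
  digitsAux-fuel {suc f} {zero}   {zero}  _ _ = refl
  digitsAux-fuel {suc f} {suc f′} {zero}  _ _ = refl
  digitsAux-fuel {suc f} {suc f′} {suc n} (s≤s n≤f) (s≤s n≤f′) =
    cong (suc n % g ∷_) (digitsAux-fuel (≤-trans (suc-/-≤ n) n≤f) (≤-trans (suc-/-≤ n) n≤f′))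

  digits-positive : ∀ m → 0 < m → digits g m ≡ m % g ∷ digits g (m / g)
  digits-positive (suc n) _ = cong (suc n % g ∷_) (digitsAux-fuel (suc-/-≤ n) ≤-refl)

  [a+g*q]%g≡a : ∀ a q → a < g → (a + g * q) % g ≡ a
  [a+g*q]%g≡a a q a<g = trans (%-remove-+ʳ a (m∣m*n q)) (m<n⇒m%n≡m a<g)

  [a+g*q]/g≡q : ∀ a q → a < g → (a + g * q) / g ≡ q
  [a+g*q]/g≡q a q a<g = begin
    (a + g * q) / g    ≡⟨ +-distrib-/-∣ʳ a (m∣m*n q) ⟩
    a / g + g * q / g  ≡⟨ cong₂ _+_ (m<n⇒m/n≡0 a<g) (trans (cong (_/ g) (*-comm g q)) (m*n/n≡m q g)) ⟩
    q                  ∎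
    where open ≡-Reasoning

  0<a+g*q : ∀ a {q} → 0 < q → 0 < a + g * q
  0<a+g*q a {q} 0<q = <-≤-trans (<-≤-trans 0<q (m≤n*m q g)) (m≤n+m (g * q) a)

  digits-+* : ∀ a q → a < g → 0 < q → digits g (a + g * q) ≡ a ∷ digits g q
  digits-+* a q a<g 0<q = trans (digits-positive _ (0<a+g*q a 0<q))
    (cong₂ (λ r s → r ∷ digits g s) ([a+g*q]%g≡a a q a<g) ([a+g*q]/g≡q a q a<g))

  digits-one : ∀ d → 0 < d → d < g → digits g d ≡ d ∷ []
  digits-one d 0<d d<g = trans (digits-positive d 0<d)
    (cong₂ (λ r s → r ∷ digits g s) (m<n⇒m%n≡m d<g) (m<n⇒m/n≡0 d<g))

  digits-two : ∀ {z x} → z < g → 0 < x → x < g → digits g (z + g * x) ≡ z ∷ x ∷ []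
  digits-two {z} {x} z<g 0<x x<g =
    trans (digits-+* z x z<g 0<x) (cong (z ∷_) (digits-one x 0<x x<g))

  digits-three : ∀ {z y x} → z < g → y < g → 0 < x → x < g →
                 digits g (z + g * (y + g * x)) ≡ z ∷ y ∷ x ∷ []
  digits-three {z} {y} z<g y<g 0<x x<g =
    trans (digits-+* z _ z<g (0<a+g*q y 0<x)) (cong (z ∷_) (digits-two y<g 0<x x<g))

  digitsAux-last-nonzero : ∀ f n → n ≤ f → 0 < n → ∃₂ λ ds d → digitsAux g f n ≡ ds ∷ʳ suc d
  digitsAux-last-nonzero (suc f) (suc n) (s≤s n≤f) _ with suc n / g in q≡
  ... | zero  = [] , n , cong₂ _∷_ (m<n⇒m%n≡m (m/n≡0⇒m<n q≡)) (digitsAux-zero f)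
  ... | suc q with digitsAux-last-nonzero f (suc q) q≤f (s≤s z≤n)
    where
      q≤f : suc q ≤ f
      q≤f = ≤-trans (≤-reflexive (sym q≡)) (≤-trans (suc-/-≤ n) n≤f)
  ...   | ds , d , e = suc n % g ∷ ds , d , cong (suc n % g ∷_) e

  palindrome⇒∤ : ∀ {m} → 0 < m → IsPalindrome g m → g ∤ m
  palindrome⇒∤ {m} 0<m pal g∣m with digitsAux-last-nonzero m m ≤-refl 0<m
  ... | ds , d , ends = 0≢1+n (∷-injectiveˡ (begin
    0 ∷ digits g (m / g)      ≡⟨ cong (_∷ digits g (m / g)) (n∣m⇒m%n≡0 m g g∣m) ⟨
    m % g ∷ digits g (m / g)  ≡⟨ digits-positive m 0<m ⟨
    digits g m                ≡⟨ pal ⟩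
    reverse (digits g m)      ≡⟨ cong reverse ends ⟩
    reverse (ds ∷ʳ suc d)     ≡⟨ reverse-++ ds (suc d ∷ []) ⟩
    suc d ∷ reverse ds        ∎))
    where open ≡-Reasoning

  palindrome-from-digits : ∀ {n l} → digits g n ≡ l → l ≡ reverse l → IsPalindrome g n
  palindrome-from-digits e l≡rev = trans e (trans l≡rev (cong reverse (sym e)))

  palindrome-digits : ∀ {n l} → IsPalindrome g n → digits g n ≡ l → l ≡ reverse l
  palindrome-digits pal e = trans (sym e) (trans pal (cong reverse e))

  palindrome-digit : ∀ {d} → d < g → IsPalindrome g d
  palindrome-digit {zero}  _   = refl
  palindrome-digit {suc d} d<g = palindrome-from-digits (digits-one (suc d) (s≤s z≤n) d<g) refl

  palindrome-two : ∀ {x} → 0 < x → x < g → IsPalindrome g (x + g * x)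
  palindrome-two 0<x x<g = palindrome-from-digits (digits-two x<g 0<x x<g) refl

  palindrome-three : ∀ {x y} → 0 < x → x < g → y < g → IsPalindrome g (x + g * (y + g * x))
  palindrome-three 0<x x<g y<g = palindrome-from-digits (digits-three x<g y<g 0<x x<g) refl

  palindrome-three⇒ends : ∀ {z y x} → z < g → y < g → 0 < x → x < g →
                          IsPalindrome g (z + g * (y + g * x)) → z ≡ x
  palindrome-three⇒ends z<g y<g 0<x x<g pal =
    ∷-injectiveˡ (palindrome-digits pal (digits-three z<g y<g 0<x x<g))

  horner : ∀ n → n ≡ n % g + g * ((n / g) % g + g * (n / g / g))
  horner n = trans (expand n) (cong (λ t → n % g + g * t) (expand (n / g)))
    where
      expand : ∀ m → m ≡ m % g + g * (m / g)
      expand m = trans (m≡m%n+[m/n]*n m g) (cong (m % g +_) (*-comm (m / g) g))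

  private instance
    g*g≢0 : NonZero (g * g)
    g*g≢0 = m*n≢0 g g

  g²≤n⇒0<n/g/g : ∀ {n} → g ^ 2 ≤ n → 0 < n / g / g
  g²≤n⇒0<n/g/g {n} g²≤n = subst (0 <_) (sym (m/n/o≡m/[n*o] n g g))
    (m≥n⇒m/n>0 (subst (_≤ n) (cong (g *_) (*-identityʳ g)) g²≤n))

  n<g³⇒n/g/g<g : ∀ {n} → n < g ^ 3 → n / g / g < g
  n<g³⇒n/g/g<g {n} n<g³ = subst (_< g) (sym (m/n/o≡m/[n*o] n g g))
    (m<n*o⇒m/o<n (subst (n <_) (cong (λ t → g * (g * t)) (*-identityʳ g)) n<g³))

  carry : ∀ {a b c x y} → x + y ≡ a + g → a + g * (suc b + g * c) ≡ (x + g * (b + g * c)) + y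
  carry {a} {b} {c} {x} {y} x+y≡a+g = begin
    a + g * (suc b + g * c)    ≡⟨ solve (a ∷ b ∷ c ∷ g ∷ []) ⟩
    (a + g) + g * (b + g * c)  ≡⟨ cong (_+ g * (b + g * c)) x+y≡a+g ⟨
    (x + y) + g * (b + g * c)  ≡⟨ solve (x ∷ y ∷ b ∷ c ∷ g ∷ []) ⟩
    (x + g * (b + g * c)) + y  ∎
    where open ≡-Reasoning

  sum-of-two-leading≤last : ∀ {a b c} → a < g → b < g → 0 < c → c < g → c ≤ a →
                            SumOfTwoPal g (a + g * (b + g * c))
  sum-of-two-leading≤last {b = b} {c} a<g b<g 0<c c<g c≤a with d , refl ← m≤n⇒∃[o]m+o≡n c≤a =
    c + g * (b + g * c) , d ,
    palindrome-three 0<c c<g b<g , palindrome-digit (≤-<-trans (m≤n+m d c) a<g) ,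
    solve (c ∷ d ∷ b ∷ g ∷ [])

  sum-of-two-borrow : ∀ {a b c} → a < c → c < g → b < g → SumOfTwoPal g (a + g * (suc b + g * c))
  sum-of-two-borrow {a} {b} {c} a<c c<g b<g
    with y , c+y≡a+g ← m≤n⇒∃[o]m+o≡n (≤-trans (<⇒≤ c<g) (m≤n+m g a)) =
    c + g * (b + g * c) , y ,
    palindrome-three 0<c c<g b<g , palindrome-digit y<g , carry {x = c} c+y≡a+g
    where
      0<c : 0 < c
      0<c = ≤-<-trans z≤n a<c
      y<g : y < g
      y<g = +-cancelˡ-< c y g (subst (_< c + g) (sym c+y≡a+g) (+-monoˡ-< g a<c))

  2g²+1-horner : 2 * g ^ 2 + 1 ≡ 1 + g * (0 + g * 2)
  2g²+1-horner = begin
    2 * g ^ 2 + 1          ≡⟨⟩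
    2 * (g * (g * 1)) + 1  ≡⟨ solve (g ∷ []) ⟩
    1 + g * (0 + g * 2)    ∎
    where open ≡-Reasoning

  2g²+1<g³ : 2 < g → 2 * g ^ 2 + 1 < g ^ 3
  2g²+1<g³ 2<g with k , 3+k≡g ← m≤n⇒∃[o]m+o≡n 2<g =
    ≤-trans (m≤m+n _ (7 + k * (15 + k * (7 + k)))) (≤-reflexive (subst cube 3+k≡g (solve (k ∷ []))))
    where
      -- 7 + k * (15 + k * (7 + k)) is g² (g − 2) − 2 at g = 3 + k
      cube : ℕ → Set
      cube t = suc (2 * (t * (t * 1)) + 1) + (7 + k * (15 + k * (7 + k))) ≡ t * (t * (t * 1))

  palindrome-three+palindrome≢2g²+1 : ∀ x {y B} → 0 < x → y < g → IsPalindrome g B →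
                                      (x + g * (y + g * x)) + B ≢ 1 + g * (0 + g * 2)
  palindrome-three+palindrome≢2g²+1 1 {y} {B} _ y<g palB sum≡ with w , 1+y+w≡g ← m≤n⇒∃[o]m+o≡n y<g =
    palindrome⇒∤ (0<a+g*q 0 (s≤s z≤n)) (subst (IsPalindrome g) B≡g*[1+w] palB) (m∣m*n (suc w))
    where
      open ≡-Reasoning
      split : (1 + g * (y + g * 1)) + g * suc w ≡ 1 + g * (0 + g * 2)
      split = begin
        (1 + g * (y + g * 1)) + g * suc w  ≡⟨ solve (y ∷ w ∷ g ∷ []) ⟩
        1 + g * (g + (suc y + w))          ≡⟨ cong (λ t → 1 + g * (g + t)) 1+y+w≡g ⟩
        1 + g * (g + g)                    ≡⟨ solve (g ∷ []) ⟩
        1 + g * (0 + g * 2)                ∎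
      B≡g*[1+w] : B ≡ g * suc w
      B≡g*[1+w] = +-cancelˡ-≡ (1 + g * (y + g * 1)) B (g * suc w) (trans sum≡ (sym split))
  palindrome-three+palindrome≢2g²+1 (suc (suc x)) {y} {B} _ _ _ sum≡ =
    m+1+n≢m _ (trans (sym split) sum≡)
    where
      split : (suc (suc x) + g * (y + g * suc (suc x))) + B
            ≡ (1 + g * (0 + g * 2)) + suc (x + g * (y + g * x) + B)
      split = solve (x ∷ y ∷ B ∷ g ∷ [])

  palindrome≥g²+palindrome≢2g²+1 : ∀ {A B} → 2 < g → g ^ 2 ≤ A →
                                   IsPalindrome g A → IsPalindrome g B → A + B ≢ 2 * g ^ 2 + 1
  palindrome≥g²+palindrome≢2g²+1 {A} {B} 2<g g²≤A palA palB A+B≡2g²+1 =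
    palindrome-three+palindrome≢2g²+1 x 0<x (m%n<n (A / g) g) palB
      (trans (cong (_+ B) (sym A≡)) (trans A+B≡2g²+1 2g²+1-horner))
    where
      x : ℕ
      x = A / g / g
      0<x : 0 < x
      0<x = g²≤n⇒0<n/g/g g²≤A
      x<g : x < g
      x<g = n<g³⇒n/g/g<g (≤-<-trans (subst (A ≤_) A+B≡2g²+1 (m≤m+n A B)) (2g²+1<g³ 2<g))
      ends : A % g ≡ x
      ends = palindrome-three⇒ends (m%n<n A g) (m%n<n (A / g) g) 0<x x<g
               (subst (IsPalindrome g) (horner A) palA)
      A≡ : A ≡ x + g * ((A / g) % g + g * x)
      A≡ = trans (horner A) (cong (λ z → z + g * ((A / g) % g + g * x)) ends)

  not-sum-of-two : 2 < g → ¬ SumOfTwoPal g (2 * g ^ 2 + 1)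
  not-sum-of-two 2<g (A , B , palA , palB , 2g²+1≡A+B) with g ^ 2 ≤? A | g ^ 2 ≤? B
  ... | yes g²≤A | _        = palindrome≥g²+palindrome≢2g²+1 2<g g²≤A palA palB (sym 2g²+1≡A+B)
  ... | no _     | yes g²≤B =
    palindrome≥g²+palindrome≢2g²+1 2<g g²≤B palB palA (trans (+-comm B A) (sym 2g²+1≡A+B))
  ... | no g²≰A  | no g²≰B  =
    <⇒≱ (+-mono-< (≰⇒> g²≰A) (≰⇒> g²≰B)) (subst (g ^ 2 + g ^ 2 ≤_) 2g²+1≡A+B 2g²≤2g²+1)
    where
      2g²≤2g²+1 : g ^ 2 + g ^ 2 ≤ 2 * g ^ 2 + 1
      2g²≤2g²+1 = ≤-trans (≤-reflexive (cong (g ^ 2 +_) (sym (+-identityʳ (g ^ 2))))) (m≤m+n _ 1)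

module _ (h : ℕ) (0<h : 0 < h) where

  -- The ring-solver goals below spell out suc h: the solver would treat g as an opaque constant.
  private
    g : ℕ
    g = suc h

  open Base g (s≤s 0<h)

  sum-of-two-square : SumOfTwoPal g (0 + g * (0 + g * 1))
  sum-of-two-square = h + g * h , 1 , palindrome-two 0<h ≤-refl , palindrome-digit (s≤s 0<h) , split
    where
      split : 0 + suc h * (0 + suc h * 1) ≡ (h + suc h * h) + 1
      split = solve (h ∷ [])

  sum-of-two-leading≡1+last : ∀ {a} → 2 + a < g → SumOfTwoPal g (2 + a + g * (0 + g * (3 + a)))
  sum-of-two-leading≡1+last {a} 2+a<g =
    1 + g * (1 + g * 1) , suc a + g * (h + g * suc a) ,
    palindrome-three (s≤s z≤n) (s≤s 0<h) (s≤s 0<h) ,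
    palindrome-three (s≤s z≤n) (<-trans (n<1+n (suc a)) 2+a<g) ≤-refl ,
    split
    where
      split : 2 + a + suc h * (0 + suc h * (3 + a))
            ≡ (1 + suc h * (1 + suc h * 1)) + (suc a + suc h * (h + suc h * suc a))
      split = solve (a ∷ h ∷ [])

  sum-of-two-zero-middle : ∀ {a c} → a < c → c < h → SumOfTwoPal g (a + g * (0 + g * suc c))
  sum-of-two-zero-middle {a} {c} a<c c<h =
    subst (SumOfTwoPal g) (sym split) (sum-of-two-borrow a<c (<-trans c<h ≤-refl) ≤-refl)
    where
      split : a + suc h * (0 + suc h * suc c) ≡ a + suc h * (suc h + suc h * c)
      split = solve (a ∷ c ∷ h ∷ [])

  sum-of-two-three-digit : ∀ a b c → a < g → b < g → 0 < c → c < g →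
                           a + g * (b + g * c) ≢ 1 + g * (0 + g * 2) →
                           SumOfTwoPal g (a + g * (b + g * c))
  sum-of-two-three-digit a b c a<g b<g 0<c c<g n≢2g²+1 with c ≤? a
  ... | yes c≤a = sum-of-two-leading≤last a<g b<g 0<c c<g c≤a
  sum-of-two-three-digit a (suc b) c _ b<g _ c<g _ | no c≰a =
    sum-of-two-borrow (≰⇒> c≰a) c<g (<-trans (n<1+n b) b<g)
  sum-of-two-three-digit a zero (suc c) a<g _ _ c<g n≢2g²+1 | no c≰a
    with m≤n⇒m<n∨m≡n (≤-pred (≰⇒> c≰a))
  ... | inj₁ a<c = sum-of-two-zero-middle a<c (≤-pred c<g)
  ... | inj₂ refl with a
  ...   | 0           = sum-of-two-square
  ...   | 1           = ⊥-elim (n≢2g²+1 refl)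
  ...   | suc (suc a) = sum-of-two-leading≡1+last a<g

  sum-of-two : ∀ n → g ^ 2 ≤ n → n < g ^ 3 → n ≢ 2 * g ^ 2 + 1 → SumOfTwoPal g n
  sum-of-two n g²≤n n<g³ n≢2g²+1 = subst (SumOfTwoPal g) (sym (horner n))
    (sum-of-two-three-digit _ _ _ (m%n<n n g) (m%n<n (n / g) g) (g²≤n⇒0<n/g/g g²≤n) (n<g³⇒n/g/g<g n<g³)
      (λ n≡2g²+1 → n≢2g²+1 (trans (horner n) (trans n≡2g²+1 (sym 2g²+1-horner)))))

  sum-of-three : SumOfThreePal g (2 * g ^ 2 + 1)
  sum-of-three =
    1 + g * (h + g * 1) , h , 1 ,
    palindrome-three (s≤s z≤n) (s≤s 0<h) ≤-refl , palindrome-digit ≤-refl , palindrome-digit (s≤s 0<h) ,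
    trans 2g²+1-horner split
    where
      split : 1 + suc h * (0 + suc h * 2) ≡ (1 + suc h * (h + suc h * 1)) + h + 1
      split = solve (h ∷ [])

lemma4p3 : (g : ℕ) → .{{_ : NonZero g}} → 5 ≤ g →
    ((n : ℕ) → g ^ 2 ≤ n → n < g ^ 3 → n ≢ 2 * g ^ 2 + 1 → SumOfTwoPal g n)
    × ¬ SumOfTwoPal g (2 * g ^ 2 + 1)
    × SumOfThreePal g (2 * g ^ 2 + 1)
lemma4p3 (suc h) (s≤s 4≤h) =
  sum-of-two h 0<h , Base.not-sum-of-two (suc h) (s≤s 0<h) (s≤s 1<h) , sum-of-three h 0<h
  where
    1<h : 1 < h
    1<h = ≤-trans (s≤s (s≤s z≤n)) 4≤h
    0<h : 0 < h
    0<h = <-trans (s≤s z≤n) 1<h
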